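{- For every prime $p>3$ there exists an integer $a$ such that $(p, B_a(p))$ is a $2$-cycle of $B_a$, i.e. $B_a(p)\neq p$ and $B_a(B_a(p))=p$.
   Context: For a positive integer $n$ with prime factorization $n=p_1^{r_1}\cdots p_k^{r_k}$, let $B(n)=\sum_{i=1}^k r_ip_i$. For an integer $a$, define $B_a(n)=n+a$ if $n$ is prime and $B_a(n)=B(n)$ otherwise. -}

module Defs where

open import Data.Nat using (ℕ; NonZero)
open import Data.Nat.Primality using (Prime; prime?)
open import Data.Nat.Primality.Factorisation using (factorise; factors)
open import Data.Nat.ListAction using (sum)
open import Data.Integer using (ℤ; +_; _+_)
open import Relation.Nullary using (yes; no)

-- B(n) = Σ r_i p_i for n = Π p_i^{r_i}: the sum of the prime factors of n
-- counted with multiplicity (B 1 = 0, empty factorisation).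
B : (n : ℕ) → .{{NonZero n}} → ℕ
B n = sum (factors (factorise n))

Ba : ℤ → (n : ℕ) → .{{NonZero n}} → ℤ
Ba a n with prime? n
... | yes _ = + n + a
... | no _  = + B n

{-# OPTIONS --safe #-}
module Submission where

-- An odd prime p > 3 is 3 + 2(k+1), the sum of the prime factors of the composite number
-- q = 3·2^(k+1). So a := q − p sends p to q, and B sends q back to p; q ≠ p as 3 ∣ q.

open import Defs
open import Data.Nat using (ℕ; NonZero; _>_; suc; zero; _+_; _*_)
open import Data.Nat.Primality using (Prime; prime?; prime⇒irreducible; ¬prime[1]; productOfPrimes≢0; prime[2])
open import Data.Nat.Primality.Factorisation using (PrimeFactorisation; factorise; factorisationUnique)
open import Data.Nat.ListAction using (sum; product)
open import Data.Nat.ListAction.Properties using (sum-↭; ∈⇒∣product)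
open import Data.Nat.Divisibility using (_∣_; divides)
open import Data.Nat.Properties using (<⇒≢; <-irrefl; <-trans; n<1+n)
open import Data.Integer using (ℤ; +_; -_) renaming (_+_ to _+ℤ_)
open import Data.Integer.Properties using (+-0-abelianGroup)
open import Algebra.Bundles using (AbelianGroup)
open import Algebra.Properties.Group (AbelianGroup.group +-0-abelianGroup) using (\\-leftDividesˡ)
open import Data.List using (List; _∷_; replicate)
open import Data.List.Relation.Unary.All using (All; _∷_)
open import Data.List.Relation.Unary.All.Properties using (replicate⁺)
open import Data.List.Relation.Unary.Any using (here; there)
open import Data.Product using (Σ; _×_; _,_; ∃)
open import Data.Sum using (_⊎_; inj₁; inj₂)
open import Data.Empty using (⊥-elim)
open import Relation.Nullary using (yes; no; ¬_)
open import Relation.Nullary.Decidable using (toWitness)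
open import Relation.Binary.PropositionalEquality using (_≡_; _≢_; refl; sym; trans; cong; subst; module ≡-Reasoning)

prime[3] : Prime 3
prime[3] = toWitness {a? = prime? 3} _

Ba-prime : ∀ a n .{{_ : NonZero n}} → Prime n → Ba a n ≡ + n +ℤ a
Ba-prime a n n-prime with prime? n
... | yes _         = refl
... | no  n-¬prime  = ⊥-elim (n-¬prime n-prime)

Ba-¬prime : ∀ a n .{{_ : NonZero n}} → ¬ Prime n → Ba a n ≡ + B n
Ba-¬prime a n n-¬prime with prime? n
... | yes n-prime = ⊥-elim (n-¬prime n-prime)
... | no  _       = refl

B-productOfPrimes : ∀ {ps} (ps-prime : All Prime ps) →
                    B (product ps) {{productOfPrimes≢0 ps-prime}} ≡ sum ps
B-productOfPrimes {ps} ps-prime =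
  sum-↭ (factorisationUnique (factorise _ {{productOfPrimes≢0 ps-prime}}) ps-factorisation)
  where
  ps-factorisation : PrimeFactorisation (product ps)
  ps-factorisation = record { factors = ps ; isFactorisation = refl ; factorsPrime = ps-prime }

prime-divisor-of-prime : ∀ {d p} → Prime d → Prime p → d ∣ p → d ≡ p
prime-divisor-of-prime d-prime p-prime d∣p with prime⇒irreducible p-prime d∣p
... | inj₁ refl = ⊥-elim (¬prime[1] d-prime)
... | inj₂ d≡p  = d≡p

2∣∧3∣⇒¬prime : ∀ {n} → 2 ∣ n → 3 ∣ n → ¬ Prime n
2∣∧3∣⇒¬prime 2∣n 3∣n n-prime
  with trans (prime-divisor-of-prime prime[2] n-prime 2∣n) (sym (prime-divisor-of-prime prime[3] n-prime 3∣n))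
... | ()

even-or-odd : ∀ n → (∃ λ k → n ≡ k * 2) ⊎ (∃ λ k → n ≡ 1 + k * 2)
even-or-odd zero    = inj₁ (0 , refl)
even-or-odd (suc n) with even-or-odd n
... | inj₁ (k , refl) = inj₂ (k , refl)
... | inj₂ (k , refl) = inj₁ (suc k , refl)

prime>3⇒≡3+[1+k]*2 : ∀ {p} → Prime p → p > 3 → ∃ λ k → p ≡ 3 + suc k * 2
prime>3⇒≡3+[1+k]*2 {p} p-prime p>3 with even-or-odd p
... | inj₁ (k , refl) =
  ⊥-elim (<⇒≢ (<-trans (n<1+n 2) p>3) (prime-divisor-of-prime prime[2] p-prime (divides k refl)))
... | inj₂ (zero , refl)          = ⊥-elim (¬prime[1] p-prime)
... | inj₂ (suc zero , refl)      = ⊥-elim (<-irrefl refl p>3)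
... | inj₂ (suc (suc k) , refl)   = k , refl

sum-replicate : ∀ n m → sum (replicate n m) ≡ n * m
sum-replicate zero    m = refl
sum-replicate (suc n) m = cong (_+_ m) (sum-replicate n m)

3∷2^[1+_] : ℕ → List ℕ
3∷2^[1+ k ] = 3 ∷ replicate (suc k) 2

3∷2^[1+k]-prime : ∀ k → All Prime 3∷2^[1+ k ]
3∷2^[1+k]-prime k = prime[3] ∷ replicate⁺ (suc k) prime[2]

sum-3∷2^[1+k] : ∀ k → sum 3∷2^[1+ k ] ≡ 3 + suc k * 2
sum-3∷2^[1+k] k = cong (_+_ 3) (sum-replicate (suc k) 2)

proposition3p3 : (p : ℕ) → .{{_ : NonZero p}} → Prime p → p > 3 →
    Σ ℤ λ a → Σ ℕ λ q → Σ (NonZero q) λ nz →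
      (Ba a p ≡ + q) × (q ≢ p) × (Ba a q {{nz}} ≡ + p)
proposition3p3 p p-prime p>3 with prime>3⇒≡3+[1+k]*2 p-prime p>3
... | k , p≡3+[1+k]*2 = a , q , q≢0 , Ba-p≡q , q≢p , Ba-q≡p
  where
  q : ℕ
  q = product 3∷2^[1+ k ]
  q≢0 : NonZero q
  q≢0 = productOfPrimes≢0 (3∷2^[1+k]-prime k)
  a : ℤ
  a = - + p +ℤ + q
  2∣q : 2 ∣ q
  2∣q = ∈⇒∣product {ns = 3∷2^[1+ k ]} (there (here refl))
  3∣q : 3 ∣ q
  3∣q = ∈⇒∣product {ns = 3∷2^[1+ k ]} (here refl)

  Ba-p≡q : Ba a p ≡ + q
  Ba-p≡q = trans (Ba-prime a p p-prime) (\\-leftDividesˡ (+ p) (+ q))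

  q≢p : q ≢ p
  q≢p q≡p = <⇒≢ p>3 (prime-divisor-of-prime prime[3] p-prime (subst (3 ∣_) q≡p 3∣q))

  Ba-q≡p : Ba a q {{q≢0}} ≡ + p
  Ba-q≡p = begin
    Ba a q {{q≢0}}     ≡⟨ Ba-¬prime a q {{q≢0}} (2∣∧3∣⇒¬prime 2∣q 3∣q) ⟩
    + B q {{q≢0}}      ≡⟨ cong +_ (B-productOfPrimes (3∷2^[1+k]-prime k)) ⟩
    + sum 3∷2^[1+ k ]  ≡⟨ cong +_ (trans (sum-3∷2^[1+k] k) (sym p≡3+[1+k]*2)) ⟩
    + p                ∎
    where open ≡-Reasoning
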